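{- For every graph $G$, $\mathrm{prox}_1(G) > \dfrac{H_E(G)}{(\Delta(G)+1)\Delta(G)}$.
   Context: All graphs are finite, connected, and without multiple edges. For a vertex $x$, $N(x)$ is its set of neighbours ($x\notin N(x)$) and $N[x]=N(x)\cup\{x\}$; $\Delta(G)$ is the maximum degree. The one-proximity game with $k$ cops: the robber first chooses a starting vertex; then in each round the cops choose (probe) vertices $u_1,\dots,u_k$ of $G$ (any vertices), and the cops win immediately if the robber's current vertex lies in $N[u_i]$ for some $i$; otherwise the robber moves to a vertex of $N[v]$, $v$ its current vertex. The robber is omniscient. $\mathrm{prox}_1(G)$ is the least positive integer $k$ such that $k$ cops have a strategy that wins after finitely many rounds. For $S\subseteq V(G)$, $\partial(S)$ is the set of edges with exactly one endpoint in $S$, and for $1\le k\le|V(G)|$, $\Phi_E(G,k)=\min_{|S|=k}|\partial(S)|$. For a function $f$ on integers, $H(f)$ is the largest integer $h$ for which there is $k_1$ with $f(k)\ge h$ for all $k_1\le k\le k_1+h-1$; $H_E(G)=H(k\mapsto\Phi_E(G,k))$ (with $k$ ranging over $1,\dots,|V(G)|$). -}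

module Defs where

open import Data.Nat using (ℕ; zero; suc; _+_; _*_; _≤_; _<_; _⊔_; _⊓_)
open import Data.Bool using (Bool; true; false; _∧_; not; if_then_else_)
open import Data.Fin using (Fin)
open import Data.List using (List; []; _∷_; map; foldr; _++_; filterᵇ)
open import Data.Nat.ListAction using (sum)
open import Data.List using (allFin)
open import Data.Vec using (Vec; []; _∷_; lookup)
open import Data.Product using (Σ; _×_; ∃)
open import Data.Sum using (_⊎_)
open import Relation.Binary.PropositionalEquality using (_≡_)

record Graph : Set where
  field
    n     : ℕ
    adj   : Fin n → Fin n → Bool
    sym   : ∀ x y → adj x y ≡ adj y x
    irrefl : ∀ x → adj x x ≡ false
open Graph public

data Reach (G : Graph) : Fin (n G) → Fin (n G) → Set where
  here : ∀ {x} → Reach G x x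
  step : ∀ {x y z} → adj G x y ≡ true → Reach G y z → Reach G x z

Connected : Graph → Set
Connected G = ∀ x y → Reach G x y

b2n : Bool → ℕ
b2n true  = 1
b2n false = 0

deg : (G : Graph) → Fin (n G) → ℕ
deg G x = sum (map (λ y → b2n (adj G x y)) (allFin (n G)))

Δ : Graph → ℕ
Δ G = foldr _⊔_ 0 (map (deg G) (allFin (n G)))

InN[_] : {G : Graph} → Fin (n G) → Fin (n G) → Set
InN[_] {G} u v = (v ≡ u) ⊎ (adj G u v ≡ true)

-- ===== the one-proximity game =====
-- Since the cops receive no information other than whether they have already
-- won, a cop strategy is a (finite) sequence of rounds of probes:
-- T rounds, and in round i cop j probes  probe i j.
RobberWalk : (G : Graph) → (ℕ → Fin (n G)) → Set
RobberWalk G r = ∀ i → InN[_] {G} (r i) (r (suc i))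

CopsWin : Graph → ℕ → Set
CopsWin G k =
  Σ ℕ λ T → Σ (ℕ → Fin k → Fin (n G)) λ probe →
    ∀ r → RobberWalk G r →
      ∃ λ i → i < T × ∃ λ j → InN[_] {G} (probe i j) (r i)

IsProx1 : Graph → ℕ → Set
IsProx1 G p = 1 ≤ p × CopsWin G p × (∀ k → 1 ≤ k → CopsWin G k → p ≤ k)

subsets : (m : ℕ) → List (Vec Bool m)
subsets zero    = [] ∷ []
subsets (suc m) = map (true ∷_) (subsets m) ++ map (false ∷_) (subsets m)

size : {m : ℕ} → Vec Bool m → ℕ
size []       = 0
size (b ∷ bs) = b2n b + size bs

-- |∂(S)| : edges with exactly one endpoint in S (each such edge counted once,
-- as the ordered pair (x , y) with x ∈ S, y ∉ S)
boundary : (G : Graph) → Vec Bool (n G) → ℕ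
boundary G S =
  sum (map (λ x → sum (map (λ y →
    b2n (lookup S x ∧ not (lookup S y) ∧ adj G x y)) (allFin (n G)))) (allFin (n G)))

minList : List ℕ → ℕ
minList []       = 0
minList (a ∷ as) = foldr _⊓_ a as

sizeIs : {m : ℕ} → ℕ → Vec Bool m → Bool
sizeIs k S = Data.Nat._≡ᵇ_ (size S) k

-- Φ_E(G,k) = min over |S| = k of |∂(S)|   (meaningful for 1 ≤ k ≤ |V(G)|)
ΦE : Graph → ℕ → ℕ
ΦE G k = minList (map (boundary G) (filterᵇ (sizeIs k) (subsets (n G))))

HasWindow : (ℕ → ℕ) → ℕ → ℕ → Set
HasWindow f N h = ∃ λ k₁ → 1 ≤ k₁ × k₁ + h ≤ suc N ×
  (∀ k → k₁ ≤ k → k < k₁ + h → h ≤ f k)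

IsH : (ℕ → ℕ) → ℕ → ℕ → Set
IsH f N h = HasWindow f N h × (∀ h' → HasWindow f N h' → h' ≤ h)

IsHE : Graph → ℕ → Set
IsHE G h = IsH (ΦE G) (n G) h

-- Suppose p(Δ+1)Δ ≤ h, where Φ_E ≥ h on the window k₁ ≤ k < k₁ + h, and fix a cop strategy. Let
-- Possible i be the set of vertices the robber can occupy at round i while having evaded all earlier
-- probes. One round of probes covers at most K = p(Δ+1) vertices, so the surviving part S of
-- Possible i has at least |Possible i| - K vertices. If k₁ ≤ |S| < k₁ + K, at least Φ_E(|S|) ≥ h ≥ KΔ
-- edges leave S, and each outside vertex receives at most Δ of them, so S gains at least K new
-- neighbours. Hence |Possible i| ≥ k₁ + K in every round, the surviving set never empties, and
-- tracing it backwards yields a robber walk that no probe ever catches.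
module Submission where

open import Defs hiding (sym)
open import Data.Nat using (ℕ; _*_; _+_; _≤_; _<_)
open import Data.Nat using (zero; suc; z≤n; s≤s; _⊓_; _⊔_; _≤?_; >-nonZero)
open import Data.Nat.Properties
open import Data.Nat.ListAction using () renaming (sum to sumᴸ)
open import Algebra.Properties.Semiring.Sum +-*-semiring
  using (sum; sum-syntax; sum-cong-≗; ∑-distrib-+; ∑-comm; *-distribˡ-sum; *-distribʳ-sum;
         sum-remove; sum-replicate-zero)
open import Data.Bool using (Bool; true; false; _∧_; _∨_; not; T)
open import Data.Bool.Properties using (T?; T-≡; T-∧; T-∨; T-not-≡; ∧-zeroʳ; ∧-identityʳ)
open import Data.Bool.ListAction using (any)
open import Data.Empty using (⊥-elim)
open import Data.Fin as F using (Fin; zero; suc; punchIn)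
open import Data.Fin.Properties using (punchInᵢ≢i; fromℕ<-injective)
open import Data.List as L using (allFin)
open import Data.List.Properties using (foldr-preservesᵒ)
open import Data.List.Membership.Propositional using (_∈_; lose)
open import Data.List.Membership.Propositional.Properties
  using (∈-allFin; ∈-map⁺; ∈-++⁺ˡ; ∈-++⁺ʳ; ∈-filter⁺)
open import Data.List.Relation.Unary.Any using (Any; here; there; satisfied)
open import Data.List.Relation.Unary.Any.Properties using (any⁺; any⁻)
open import Data.Product using (∃; _×_; _,_; proj₁; proj₂)
open import Data.Sum using (_⊎_; inj₁; inj₂; [_,_])
open import Data.Vec as V using (Vec; []; _∷_)
open import Data.Vec.Functional using (Vector)
open import Data.Vec.Properties using (lookup∘tabulate)
open import Function using (_∘_; id)
open import Function.Bundles using (module Equivalence)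
open import Relation.Binary.PropositionalEquality
  using (_≡_; _≢_; refl; sym; trans; cong; cong₂; subst; module ≡-Reasoning)
open import Relation.Nullary using (¬_; does; yes; no)
open import Relation.Nullary.Decidable using (dec-true; dec-false)

∑-mono-≤ : ∀ {m} {f g : Vector ℕ m} → (∀ i → f i ≤ g i) → sum f ≤ sum g
∑-mono-≤ {zero}  f≤g = z≤n
∑-mono-≤ {suc m} f≤g = +-mono-≤ (f≤g zero) (∑-mono-≤ (f≤g ∘ suc))

∑-const : ∀ m c → ∑[ i < m ] c ≡ m * c
∑-const zero    c = refl
∑-const (suc m) c = cong (c +_) (∑-const m c)

term≤∑ : ∀ {m} (f : Vector ℕ m) i → f i ≤ sum f
term≤∑ f zero    = m≤m+n _ _
term≤∑ f (suc i) = ≤-trans (term≤∑ (f ∘ suc) i) (m≤n+m _ _)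

sumᴸ-map-tabulate : ∀ {A : Set} {m} (f : A → ℕ) (g : Fin m → A) →
  sumᴸ (L.map f (L.tabulate g)) ≡ sum (f ∘ g)
sumᴸ-map-tabulate {m = zero}  f g = refl
sumᴸ-map-tabulate {m = suc m} f g = cong (f (g zero) +_) (sumᴸ-map-tabulate f (g ∘ suc))

sumᴸ-map-allFin : ∀ {m} (f : Fin m → ℕ) → sumᴸ (L.map f (allFin m)) ≡ sum f
sumᴸ-map-allFin f = sumᴸ-map-tabulate f id

1≤b2n : ∀ {b} → T b → 1 ≤ b2n b
1≤b2n {true} _ = ≤-refl

b2n-≤-* : ∀ {a b c} → (T c → T a × T b) → b2n c ≤ b2n a * b2n b
b2n-≤-* {c = false}            _    = z≤n
b2n-≤-* {true}  {true}  {true} _    = ≤-refl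
b2n-≤-* {false} {_}     {true} c⇒ab = ⊥-elim (proj₁ (c⇒ab _))
b2n-≤-* {true}  {false} {true} c⇒ab = ⊥-elim (proj₂ (c⇒ab _))

anyᶠ : ∀ {m} → Vector Bool m → Bool
anyᶠ {m} f = any f (allFin m)

anyᶠ⁺ : ∀ {m} (f : Vector Bool m) i → T (f i) → T (anyᶠ f)
anyᶠ⁺ f i fi = any⁺ f (lose (∈-allFin i) fi)

anyᶠ⁻ : ∀ {m} (f : Vector Bool m) → T (anyᶠ f) → ∃ (T ∘ f)
anyᶠ⁻ {m} f any-f = satisfied (any⁻ f (allFin m) any-f)

b2n-anyᶠ≤∑ : ∀ {m} (f : Vector Bool m) → b2n (anyᶠ f) ≤ sum (b2n ∘ f)
b2n-anyᶠ≤∑ f with anyᶠ f in eq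
... | false = z≤n
... | true with anyᶠ⁻ f (subst T (sym eq) _)
...   | i , fi = ≤-trans (1≤b2n fi) (term≤∑ (b2n ∘ f) i)

-- Finite sets as Boolean vectors

∣_∣ : ∀ {m} → Vector Bool m → ℕ
∣ A ∣ = sum (b2n ∘ A)

full : ∀ {m} → Vector Bool m
full _ = true

⁅_⁆ : ∀ {m} → Fin m → Vector Bool m
⁅ u ⁆ v = does (v F.≟ u)

infixr 6 _∪_
infixl 7 _∖_

_∪_ _∖_ : ∀ {m} → Vector Bool m → Vector Bool m → Vector Bool m
(A ∪ B) v = A v ∨ B v
(A ∖ B) v = A v ∧ not (B v)

⋃ : ∀ {m p} → (Fin p → Vector Bool m) → Vector Bool m
⋃ A v = anyᶠ (λ j → A j v)

∣full∣ : ∀ m → ∣ full {m} ∣ ≡ m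
∣full∣ m = trans (∑-const m 1) (*-identityʳ m)

∣⁅⁆∣≡1 : ∀ {m} (u : Fin m) → ∣ ⁅ u ⁆ ∣ ≡ 1
∣⁅⁆∣≡1 {suc m} u = begin
  ∣ ⁅ u ⁆ ∣
    ≡⟨ sum-remove {i = u} (b2n ∘ ⁅ u ⁆) ⟩
  b2n (does (u F.≟ u)) + ∑[ j < m ] b2n (⁅ u ⁆ (punchIn u j))
    ≡⟨ cong₂ _+_ (cong b2n (dec-true (u F.≟ u) refl))
                 (sum-cong-≗ λ j → cong b2n (dec-false (punchIn u j F.≟ u) (punchInᵢ≢i u j))) ⟩
  1 + ∑[ j < m ] 0
    ≡⟨ cong suc (sum-replicate-zero m) ⟩
  1 ∎
  where open ≡-Reasoning

∣∪∣≤∣∣+∣∣ : ∀ {m} (A B : Vector Bool m) → ∣ A ∪ B ∣ ≤ ∣ A ∣ + ∣ B ∣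
∣∪∣≤∣∣+∣∣ A B = ≤-trans (∑-mono-≤ (λ v → pointwise (A v) (B v)))
  (≤-reflexive (∑-distrib-+ (b2n ∘ A) (b2n ∘ B)))
  where
  pointwise : ∀ a b → b2n (a ∨ b) ≤ b2n a + b2n b
  pointwise true  b = s≤s z≤n
  pointwise false b = ≤-refl

∣∪∣≡∣∣+∣∖∣ : ∀ {m} (A B : Vector Bool m) → ∣ A ∪ B ∣ ≡ ∣ A ∣ + ∣ B ∖ A ∣
∣∪∣≡∣∣+∣∖∣ A B = trans (sum-cong-≗ (λ v → pointwise (A v) (B v)))
  (∑-distrib-+ (b2n ∘ A) (b2n ∘ (B ∖ A)))
  where
  pointwise : ∀ a b → b2n (a ∨ b) ≡ b2n a + b2n (b ∧ not a)
  pointwise true  b = cong (suc ∘ b2n) (sym (∧-zeroʳ b))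
  pointwise false b = cong b2n (sym (∧-identityʳ b))

∣∣≤∣∖∣+∣∣ : ∀ {m} (A B : Vector Bool m) → ∣ A ∣ ≤ ∣ A ∖ B ∣ + ∣ B ∣
∣∣≤∣∖∣+∣∣ A B = ≤-trans (∑-mono-≤ (λ v → pointwise (A v) (B v)))
  (≤-reflexive (∑-distrib-+ (b2n ∘ (A ∖ B)) (b2n ∘ B)))
  where
  pointwise : ∀ a b → b2n a ≤ b2n (a ∧ not b) + b2n b
  pointwise true  true  = ≤-refl
  pointwise true  false = ≤-refl
  pointwise false b     = z≤n

∣⋃∣≤∑∣∣ : ∀ {m p} (A : Fin p → Vector Bool m) → ∣ ⋃ A ∣ ≤ ∑[ j < p ] ∣ A j ∣
∣⋃∣≤∑∣∣ {m} {p} A = begin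
  ∣ ⋃ A ∣                             ≤⟨ ∑-mono-≤ (λ v → b2n-anyᶠ≤∑ (λ j → A j v)) ⟩
  ∑[ v < m ] ∑[ j < p ] b2n (A j v)   ≡⟨ ∑-comm (λ v j → b2n (A j v)) ⟩
  ∑[ j < p ] ∣ A j ∣                   ∎
  where open ≤-Reasoning

nonempty : ∀ {m} (A : Vector Bool m) → 1 ≤ ∣ A ∣ → ∃ (T ∘ A)
nonempty {suc m} A 1≤∣A∣ with A zero in eq
... | true  = zero , subst T (sym eq) _
... | false with nonempty (A ∘ suc) 1≤∣A∣
...   | v , Av = suc v , Av

size-tabulate : ∀ {m} (A : Vector Bool m) → size (V.tabulate A) ≡ ∣ A ∣
size-tabulate {zero}  A = refl
size-tabulate {suc m} A = cong (b2n (A zero) +_) (size-tabulate (A ∘ suc))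

∈-subsets : ∀ {m} (S : Vec Bool m) → S ∈ subsets m
∈-subsets []                  = here refl
∈-subsets {suc m} (true  ∷ S) = ∈-++⁺ˡ (∈-map⁺ (true ∷_) (∈-subsets S))
∈-subsets {suc m} (false ∷ S) = ∈-++⁺ʳ (L.map (true ∷_) (subsets m)) (∈-map⁺ (false ∷_) (∈-subsets S))

minList-≤ : ∀ {x xs} → x ∈ xs → minList xs ≤ x
minList-≤ {x} {a L.∷ as} x∈ = foldr-preservesᵒ {P = _≤ x} keeps a as (start x∈)
  where
  keeps : ∀ b c → b ≤ x ⊎ c ≤ x → b ⊓ c ≤ x
  keeps b c = [ m≤n⇒m⊓o≤n c , m≤n⇒o⊓m≤n b ]
  start : x ∈ a L.∷ as → a ≤ x ⊎ Any (_≤ x) as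
  start (here refl)  = inj₁ ≤-refl
  start (there x∈as) = inj₂ (lose x∈as ≤-refl)

module _ (G : Graph) where

  private
    Vertex    = Fin (n G)
    VertexSet = Vector Bool (n G)

  deg≡∑ : ∀ x → deg G x ≡ ∑[ y < n G ] b2n (adj G x y)
  deg≡∑ x = sumᴸ-map-allFin (λ y → b2n (adj G x y))

  deg≤Δ : ∀ x → deg G x ≤ Δ G
  deg≤Δ x = foldr-preservesᵒ {P = deg G x ≤_} keeps 0 _
    (inj₂ (lose (∈-map⁺ (deg G) (∈-allFin x)) ≤-refl))
    where
    keeps : ∀ a b → deg G x ≤ a ⊎ deg G x ≤ b → deg G x ≤ a ⊔ b
    keeps a b = [ m≤n⇒m≤n⊔o b , m≤n⇒m≤o⊔n a ]

  edge-on-path : ∀ {x y} → x ≢ y → Reach G x y → ∃ λ z → adj G x z ≡ true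
  edge-on-path x≢x here = ⊥-elim (x≢x refl)
  edge-on-path _   (step {y = z} xz _) = z , xz

  adj⇒1≤Δ : ∀ {x z} → adj G x z ≡ true → 1 ≤ Δ G
  adj⇒1≤Δ {x} {z} xz = begin
    1                              ≤⟨ 1≤b2n (Equivalence.from T-≡ xz) ⟩
    b2n (adj G x z)                ≤⟨ term≤∑ (b2n ∘ adj G x) z ⟩
    ∑[ y < n G ] b2n (adj G x y)   ≡⟨ deg≡∑ x ⟨
    deg G x                        ≤⟨ deg≤Δ x ⟩
    Δ G                            ∎
    where open ≤-Reasoning

  connected⇒1≤Δ : Connected G → 2 ≤ n G → 1 ≤ Δ G
  connected⇒1≤Δ conn 2≤n = adj⇒1≤Δ (proj₂ (edge-on-path v₀≢v₁ (conn v₀ v₁)))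
    where
    v₀ v₁ : Vertex
    v₀ = F.fromℕ< (≤-trans (s≤s z≤n) 2≤n)
    v₁ = F.fromℕ< 2≤n
    v₀≢v₁ : v₀ ≢ v₁
    v₀≢v₁ v₀≡v₁ with fromℕ<-injective 0 1 (≤-trans (s≤s z≤n) 2≤n) 2≤n v₀≡v₁
    ... | ()

  N[_] : Vertex → VertexSet
  N[ u ] = ⁅ u ⁆ ∪ adj G u

  InN⇒∈N : ∀ {u v} → InN[_] {G} u v → T (N[ u ] v)
  InN⇒∈N {u} (inj₁ refl) =
    Equivalence.from T-∨ (inj₁ (Equivalence.from T-≡ (dec-true (u F.≟ u) refl)))
  InN⇒∈N     (inj₂ uv)   = Equivalence.from T-∨ (inj₂ (Equivalence.from T-≡ uv))

  ∣N[]∣≤1+Δ : ∀ u → ∣ N[ u ] ∣ ≤ 1 + Δ G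
  ∣N[]∣≤1+Δ u = begin
    ∣ N[ u ] ∣                    ≤⟨ ∣∪∣≤∣∣+∣∣ ⁅ u ⁆ (adj G u) ⟩
    ∣ ⁅ u ⁆ ∣ + ∣ adj G u ∣        ≡⟨ cong₂ _+_ (∣⁅⁆∣≡1 u) (sym (deg≡∑ u)) ⟩
    1 + deg G u                   ≤⟨ +-monoʳ-≤ 1 (deg≤Δ u) ⟩
    1 + Δ G                       ∎
    where open ≤-Reasoning

  Nᵒ : VertexSet → VertexSet
  Nᵒ A y = anyᶠ (λ x → A x ∧ adj G x y)

  ∂ᵥ : VertexSet → VertexSet
  ∂ᵥ A = Nᵒ A ∖ A

  edgeBoundary : VertexSet → ℕ
  edgeBoundary A = ∑[ x < n G ] ∑[ y < n G ] b2n (A x ∧ not (A y) ∧ adj G x y)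

  boundary-tabulate : ∀ A → boundary G (V.tabulate A) ≡ edgeBoundary A
  boundary-tabulate A =
    trans (sumᴸ-map-allFin {n G} _) (sum-cong-≗ {n G} λ x →
    trans (sumᴸ-map-allFin {n G} _) (sum-cong-≗ {n G} λ y →
    cong₂ (λ a b → b2n (a ∧ not b ∧ adj G x y)) (lookup∘tabulate A x) (lookup∘tabulate A y)))

  -- Crossing edges are counted by their endpoint outside A, which lies in ∂ᵥ A and has degree ≤ Δ.
  edgeBoundary≤Δ*∣∂ᵥ∣ : ∀ A → edgeBoundary A ≤ Δ G * ∣ ∂ᵥ A ∣
  edgeBoundary≤Δ*∣∂ᵥ∣ A = begin
    edgeBoundary A
      ≡⟨ ∑-comm (λ x y → b2n (A x ∧ not (A y) ∧ adj G x y)) ⟩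
    ∑[ y < n G ] ∑[ x < n G ] b2n (A x ∧ not (A y) ∧ adj G x y)
      ≤⟨ ∑-mono-≤ (λ y → ∑-mono-≤ (λ x → b2n-≤-* (crossing x y))) ⟩
    ∑[ y < n G ] ∑[ x < n G ] (b2n (adj G y x) * b2n (∂ᵥ A y))
      ≡⟨ sum-cong-≗ (λ y → *-distribʳ-sum (b2n (∂ᵥ A y)) (b2n ∘ adj G y)) ⟨
    ∑[ y < n G ] (∑[ x < n G ] b2n (adj G y x) * b2n (∂ᵥ A y))
      ≡⟨ sum-cong-≗ (λ y → cong (_* b2n (∂ᵥ A y)) (deg≡∑ y)) ⟨
    ∑[ y < n G ] (deg G y * b2n (∂ᵥ A y))
      ≤⟨ ∑-mono-≤ (λ y → *-monoˡ-≤ (b2n (∂ᵥ A y)) (deg≤Δ y)) ⟩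
    ∑[ y < n G ] (Δ G * b2n (∂ᵥ A y))
      ≡⟨ *-distribˡ-sum (Δ G) (b2n ∘ ∂ᵥ A) ⟨
    Δ G * ∣ ∂ᵥ A ∣ ∎
    where
    open ≤-Reasoning
    crossing : ∀ x y → T (A x ∧ not (A y) ∧ adj G x y) → T (adj G y x) × T (∂ᵥ A y)
    crossing x y Ax∧¬Ay∧xy with Equivalence.to T-∧ Ax∧¬Ay∧xy
    ... | Ax , ¬Ay∧xy with Equivalence.to T-∧ ¬Ay∧xy
    ...   | ¬Ay , xy = subst T (Graph.sym G x y) xy
                     , Equivalence.from T-∧ (anyᶠ⁺ _ x (Equivalence.from T-∧ (Ax , xy)) , ¬Ay)

  ΦE≤boundary : ∀ S → ΦE G (size S) ≤ boundary G S
  ΦE≤boundary S = minList-≤ (∈-map⁺ (boundary G)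
    (∈-filter⁺ (T? ∘ sizeIs (size S)) (∈-subsets S) (≡⇒≡ᵇ (size S) (size S) refl)))

  ΦE≤Δ*∣∂ᵥ∣ : ∀ A → ΦE G ∣ A ∣ ≤ Δ G * ∣ ∂ᵥ A ∣
  ΦE≤Δ*∣∂ᵥ∣ A = begin
    ΦE G ∣ A ∣                     ≡⟨ cong (ΦE G) (size-tabulate A) ⟨
    ΦE G (size (V.tabulate A))     ≤⟨ ΦE≤boundary (V.tabulate A) ⟩
    boundary G (V.tabulate A)      ≡⟨ boundary-tabulate A ⟩
    edgeBoundary A                 ≤⟨ edgeBoundary≤Δ*∣∂ᵥ∣ A ⟩
    Δ G * ∣ ∂ᵥ A ∣                  ∎
    where open ≤-Reasoning

  ΦE-n≡0 : ΦE G (n G) ≡ 0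
  ΦE-n≡0 = n≤0⇒n≡0 (begin
    ΦE G (n G)                            ≡⟨ cong (ΦE G) (∣full∣ (n G)) ⟨
    ΦE G ∣ allVertices ∣                   ≡⟨ cong (ΦE G) (size-tabulate allVertices) ⟨
    ΦE G (size (V.tabulate allVertices))  ≤⟨ ΦE≤boundary (V.tabulate allVertices) ⟩
    boundary G (V.tabulate allVertices)   ≡⟨ boundary-tabulate allVertices ⟩
    ∑[ x < n G ] ∑[ y < n G ] 0            ≡⟨ sum-cong-≗ {n G} (λ _ → sum-replicate-zero (n G)) ⟩
    ∑[ x < n G ] 0                        ≡⟨ sum-replicate-zero (n G) ⟩
    0                                     ∎)
    where
    open ≤-Reasoning
    allVertices : VertexSet
    allVertices = full

  -- Evading the cops

  walk-through : (A : ℕ → Vertex → Set) →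
    (∀ {i v} → A (suc i) v → ∃ λ u → A i u × InN[_] {G} u v) →
    ∀ m {v} → A m v → ∃ λ r → RobberWalk G r × (∀ i → i ≤ m → A i (r i)) × r m ≡ v
  walk-through A back zero {v} Av = (λ _ → v) , (λ _ → inj₁ refl) , (λ { zero z≤n → Av }) , refl
  walk-through A back (suc m) {v} Av with back Av
  ... | u , Au , u~v with walk-through A back m Au
  ...   | r , r-walk , r∈A , rm≡u = extended , extended-walk , extended∈A , extended-end
    where
    extended : ℕ → Vertex
    extended i with i ≤? m
    ... | yes _ = r i
    ... | no  _ = v
    extended-walk : RobberWalk G extended
    extended-walk i with i ≤? m | suc i ≤? m
    ... | yes _   | yes _     = r-walk i
    ... | yes i≤m | no 1+i≰m  = subst (λ w → InN[_] {G} w v)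
                                  (sym (trans (cong r (≤-antisym i≤m (≮⇒≥ 1+i≰m))) rm≡u)) u~v
    ... | no i≰m  | yes 1+i≤m = ⊥-elim (i≰m (<⇒≤ 1+i≤m))
    ... | no _    | no _      = inj₁ refl
    extended∈A : ∀ i → i ≤ suc m → A i (extended i)
    extended∈A i i≤1+m with i ≤? m
    ... | yes i≤m = r∈A i i≤m
    ... | no  i≰m = subst (λ j → A j v) (sym (≤-antisym i≤1+m (≰⇒> i≰m))) Av
    extended-end : extended (suc m) ≡ v
    extended-end with suc m ≤? m
    ... | yes 1+m≤m = ⊥-elim (1+n≰n 1+m≤m)
    ... | no  _     = refl

  module Evasion {p} (probe : ℕ → Fin p → Vertex) (k₁ : ℕ)
    (room : k₁ + p * (1 + Δ G) ≤ n G)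
    (expands : ∀ A → k₁ ≤ ∣ A ∣ → ∣ A ∣ < k₁ + p * (1 + Δ G) → p * (1 + Δ G) ≤ ∣ ∂ᵥ A ∣)
    where

    private
      K : ℕ
      K = p * (1 + Δ G)

    Probed : ℕ → VertexSet
    Probed i = ⋃ (λ j → N[ probe i j ])

    Possible Safe : ℕ → VertexSet
    Possible zero      = full
    Possible (suc i)   = Safe i ∪ Nᵒ (Safe i)
    Safe i = Possible i ∖ Probed i

    ∣Probed∣≤K : ∀ i → ∣ Probed i ∣ ≤ K
    ∣Probed∣≤K i = begin
      ∣ Probed i ∣                     ≤⟨ ∣⋃∣≤∑∣∣ (λ j → N[ probe i j ]) ⟩
      ∑[ j < p ] ∣ N[ probe i j ] ∣     ≤⟨ ∑-mono-≤ (λ j → ∣N[]∣≤1+Δ (probe i j)) ⟩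
      ∑[ j < p ] (1 + Δ G)             ≡⟨ ∑-const p (1 + Δ G) ⟩
      K                                ∎
      where open ≤-Reasoning

    k₁≤∣Safe∣ : ∀ i → k₁ + K ≤ ∣ Possible i ∣ → k₁ ≤ ∣ Safe i ∣
    k₁≤∣Safe∣ i large = +-cancelʳ-≤ K k₁ ∣ Safe i ∣ (begin
      k₁ + K                           ≤⟨ large ⟩
      ∣ Possible i ∣                    ≤⟨ ∣∣≤∣∖∣+∣∣ (Possible i) (Probed i) ⟩
      ∣ Safe i ∣ + ∣ Probed i ∣          ≤⟨ +-monoʳ-≤ ∣ Safe i ∣ (∣Probed∣≤K i) ⟩
      ∣ Safe i ∣ + K                    ∎)
      where open ≤-Reasoning

    k₁+K≤∣Possible∣ : ∀ i → k₁ + K ≤ ∣ Possible i ∣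
    k₁+K≤∣Possible∣ zero = ≤-trans room (≤-reflexive (sym (∣full∣ (n G))))
    k₁+K≤∣Possible∣ (suc i) = begin
      k₁ + K                            ≤⟨ grows ⟩
      ∣ Safe i ∣ + ∣ ∂ᵥ (Safe i) ∣         ≡⟨ ∣∪∣≡∣∣+∣∖∣ (Safe i) (Nᵒ (Safe i)) ⟨
      ∣ Possible (suc i) ∣               ∎
      where
      open ≤-Reasoning
      k₁≤∣Safe-i∣ : k₁ ≤ ∣ Safe i ∣
      k₁≤∣Safe-i∣ = k₁≤∣Safe∣ i (k₁+K≤∣Possible∣ i)
      grows : k₁ + K ≤ ∣ Safe i ∣ + ∣ ∂ᵥ (Safe i) ∣
      grows with k₁ + K ≤? ∣ Safe i ∣
      ... | yes large = ≤-trans large (m≤m+n _ _)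
      ... | no  small = +-mono-≤ k₁≤∣Safe-i∣ (expands (Safe i) k₁≤∣Safe-i∣ (≰⇒> small))

    Safe-back : ∀ {i v} → T (Safe (suc i) v) → ∃ λ u → T (Safe i u) × InN[_] {G} u v
    Safe-back {i} {v} v∈Safe with Equivalence.to T-∨ (proj₁ (Equivalence.to T-∧ v∈Safe))
    ... | inj₁ v∈Safe-i = v , v∈Safe-i , inj₁ refl
    ... | inj₂ v∈Nᵒ with anyᶠ⁻ (λ x → Safe i x ∧ adj G x v) v∈Nᵒ
    ...   | u , u∈Safe-i∧uv with Equivalence.to T-∧ u∈Safe-i∧uv
    ...     | u∈Safe-i , uv = u , u∈Safe-i , inj₂ (Equivalence.to T-≡ uv)

    Safe⇒unprobed : ∀ {i v} → T (Safe i v) → ∀ j → ¬ InN[_] {G} (probe i j) v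
    Safe⇒unprobed {i} {v} v∈Safe j v∈N = subst T (Equivalence.to T-not-≡ v∉Probed) v∈Probed
      where
      v∉Probed = proj₂ (Equivalence.to T-∧ v∈Safe)
      v∈Probed = anyᶠ⁺ (λ j → N[ probe i j ] v) j (InN⇒∈N v∈N)

    escapes : 1 ≤ k₁ → ∀ t →
      ∃ λ r → RobberWalk G r × ∀ i → i < t → ∀ j → ¬ InN[_] {G} (probe i j) (r i)
    escapes k₁≥1 t with nonempty (Safe t) (≤-trans k₁≥1 (k₁≤∣Safe∣ t (k₁+K≤∣Possible∣ t)))
    ... | v , v∈Safe with walk-through (λ i w → T (Safe i w)) Safe-back t v∈Safe
    ...   | r , r-walk , r∈Safe , _ = r , r-walk , λ i i<t → Safe⇒unprobed (r∈Safe i (<⇒≤ i<t))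

  window-fits : ∀ {k₁ h} → 1 ≤ h → k₁ + h ≤ suc (n G) →
    (∀ k → k₁ ≤ k → k < k₁ + h → h ≤ ΦE G k) → k₁ + h ≤ n G
  window-fits {k₁} {h} h≥1 fits window with m≤n⇒m<n∨m≡n fits
  ... | inj₁ k₁+h<1+n = ≤-pred k₁+h<1+n
  ... | inj₂ k₁+h≡1+n = ⊥-elim (1+n≰n (begin
    1          ≤⟨ h≥1 ⟩
    h          ≤⟨ window (n G) k₁≤n n<k₁+h ⟩
    ΦE G (n G) ≡⟨ ΦE-n≡0 ⟩
    0          ∎))
    where
    open ≤-Reasoning
    n<k₁+h : n G < k₁ + h
    n<k₁+h = ≤-reflexive (sym k₁+h≡1+n)
    k₁≤n : k₁ ≤ n G
    k₁≤n = ≤-pred (subst (k₁ <_) k₁+h≡1+n (m<m+n k₁ h≥1))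

  window-expands : ∀ {k₁ h K} → 1 ≤ Δ G → K * Δ G ≤ h →
    (∀ k → k₁ ≤ k → k < k₁ + h → h ≤ ΦE G k) →
    ∀ A → k₁ ≤ ∣ A ∣ → ∣ A ∣ < k₁ + K → K ≤ ∣ ∂ᵥ A ∣
  window-expands {k₁} {h} {K} 1≤Δ KΔ≤h window A k₁≤∣A∣ ∣A∣<k₁+K =
    *-cancelʳ-≤ K ∣ ∂ᵥ A ∣ (Δ G) {{>-nonZero 1≤Δ}} (begin
      K * Δ G            ≤⟨ KΔ≤h ⟩
      h                  ≤⟨ window ∣ A ∣ k₁≤∣A∣ ∣A∣<k₁+h ⟩
      ΦE G ∣ A ∣          ≤⟨ ΦE≤Δ*∣∂ᵥ∣ A ⟩
      Δ G * ∣ ∂ᵥ A ∣      ≡⟨ *-comm (Δ G) ∣ ∂ᵥ A ∣ ⟩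
      ∣ ∂ᵥ A ∣ * Δ G      ∎)
    where
    open ≤-Reasoning
    ∣A∣<k₁+h : ∣ A ∣ < k₁ + h
    ∣A∣<k₁+h = <-≤-trans ∣A∣<k₁+K (+-monoʳ-≤ k₁ (≤-trans (m≤m*n K (Δ G) {{>-nonZero 1≤Δ}}) KΔ≤h))

robber-escapes : ∀ G → Connected G → 2 ≤ n G → ∀ {p h} → 1 ≤ p →
  HasWindow (ΦE G) (n G) h → p * ((Δ G + 1) * Δ G) ≤ h →
  (probe : ℕ → Fin p → Fin (n G)) → ∀ t →
  ∃ λ r → RobberWalk G r × ∀ i → i < t → ∀ j → ¬ InN[_] {G} (probe i j) (r i)
robber-escapes G conn 2≤n {p} {h} p≥1 (k₁ , k₁≥1 , fits , window) large probe =
  Evasion.escapes G probe k₁ room (window-expands G 1≤Δ KΔ≤h window) k₁≥1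
  where
  open ≤-Reasoning
  1≤Δ : 1 ≤ Δ G
  1≤Δ = connected⇒1≤Δ G conn 2≤n
  K : ℕ
  K = p * (1 + Δ G)
  KΔ≤h : K * Δ G ≤ h
  KΔ≤h = begin
    p * (1 + Δ G) * Δ G     ≡⟨ *-assoc p (1 + Δ G) (Δ G) ⟩
    p * ((1 + Δ G) * Δ G)   ≡⟨ cong (λ d → p * (d * Δ G)) (+-comm 1 (Δ G)) ⟩
    p * ((Δ G + 1) * Δ G)   ≤⟨ large ⟩
    h                       ∎
  K≤h : K ≤ h
  K≤h = ≤-trans (m≤m*n K (Δ G) {{>-nonZero 1≤Δ}}) KΔ≤h
  room : k₁ + K ≤ n G
  room = ≤-trans (+-monoʳ-≤ k₁ K≤h)
    (window-fits G (≤-trans (*-mono-≤ p≥1 (s≤s z≤n)) K≤h) fits window)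

mainTheorem16 : (G : Graph) → Connected G → 2 ≤ n G →
    ∀ p h → IsProx1 G p → IsHE G h →
    h < p * ((Δ G + 1) * Δ G)
mainTheorem16 G conn 2≤n p h (p≥1 , (t , probe , caught) , _) (window , _) = ≰⇒> λ large →
  let r , r-walk , evades = robber-escapes G conn 2≤n p≥1 window large probe t
      i , i<t , j , caught-i = caught r r-walk
  in evades i i<t j caught-i
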